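{- For every monoid morphism $f\colon \mathbb{N}_+\to\mathbb{Z}/2\mathbb{Z}$ (i.e. $f(xy)=f(x)+f(y)$ for all $x,y\in\mathbb{N}_+$), there exists a primitive Pythagorean triple $(a,b,c)$ with $a,b,c\in[1,533]$ and $f(a)=f(b)=f(c)$. Moreover, $533$ is minimal with this property: there exists a monoid morphism $f\colon\mathbb{N}_+\to\mathbb{Z}/2\mathbb{Z}$ such that no primitive Pythagorean triple with all entries in $[1,532]$ is monochromatic under $f$.
   Context: $\mathbb{N}_+$ denotes the positive integers and $[a,b]=\{c\in\mathbb{N}: a\le c\le b\}$. A Pythagorean triple is a triple $(a,b,c)$ of positive integers with $a^2+b^2=c^2$; it is primitive if $\gcd(a,b,c)=1$. A triple is monochromatic under $f$ if $f(a)=f(b)=f(c)$. -}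

module Defs where

open import Data.Nat using (ℕ; _+_; _*_; _≤_; _^_)
open import Data.Nat.GCD using (gcd)
open import Data.Bool using (Bool; false; _xor_)
open import Data.Product using (_×_)
open import Relation.Binary.PropositionalEquality using (_≡_)

-- ℤ/2ℤ is represented by Bool with addition _xor_ and zero false.
-- A monoid morphism ℕ₊ → ℤ/2ℤ is represented by a function f : ℕ → Bool
-- whose values at positive arguments matter; the value at 0 is irrelevant
-- (it is never used by the predicates below).
IsMonoidMorphism : (ℕ → Bool) → Set
IsMonoidMorphism f =
  (f 1 ≡ false) ×
  (∀ x y → 1 ≤ x → 1 ≤ y → f (x * y) ≡ f x xor f y)

PythagoreanTriple : ℕ → ℕ → ℕ → Set
PythagoreanTriple a b c =
  (1 ≤ a) × (1 ≤ b) × (1 ≤ c) × (a ^ 2 + b ^ 2 ≡ c ^ 2)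

Primitive : ℕ → ℕ → ℕ → Set
Primitive a b c = gcd a (gcd b c) ≡ 1

PrimitivePythagoreanTriple : ℕ → ℕ → ℕ → Set
PrimitivePythagoreanTriple a b c = PythagoreanTriple a b c × Primitive a b c

Monochromatic : (ℕ → Bool) → ℕ → ℕ → ℕ → Set
Monochromatic f a b c = (f a ≡ f b) × (f b ≡ f c)

InRange : ℕ → ℕ → ℕ → ℕ → Set
InRange N a b c = (1 ≤ a) × (a ≤ N) × (1 ≤ b) × (b ≤ N) × (1 ≤ c) × (c ≤ N)

-- A monoid morphism f : ℕ₊ → ℤ/2ℤ is determined by its values on the primes: f n is the sum of
-- f p over the primes p dividing n to an odd power. For the first half it therefore suffices to
-- branch on the colours of finitely many primes (43 of them suffice), until every branch fixes the
-- colours of all three entries of some primitive triple with entries at most 533 and makes them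
-- equal; the branching is recorded as a decision tree and checked by evaluation. For minimality,
-- colour n by the parity of the number of its prime factors, counted with multiplicity, that lie in
-- {3, 7, 11, 13, 17, 19, 29, 41, 53, 89, 101, 257, 313}; an exhaustive search over all pairs of legs
-- up to 532 shows that no primitive triple below 533 is monochromatic.

module Submission where

open import Defs
open import Algebra.Bundles using (CommutativeRing)
open import Data.Bool using (Bool; true; false; not; _xor_; _∧_; T)
open import Data.Bool.Properties using (xor-same; xor-assoc; not-distribˡ-xor; not-distribʳ-xor; T-∧; xor-∧-commutativeRing)
import Data.Bool.Properties as Bool
open import Data.Empty using (⊥-elim)
open import Data.List using (List; []; _∷_; foldr)
open import Data.List.Relation.Unary.All using (All; []; _∷_; all?)
open import Data.Maybe using (Maybe; just; nothing; zipWith)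
open import Data.Nat using (ℕ; zero; suc; pred; _+_; _*_; _∸_; _^_; _≤_; _<_; _≤?_; _<?_; _≟_; z≤n; s≤s; NonZero; NonTrivial; nonTrivial⇒nonZero; nonTrivial⇒n>1; nonTrivial⇒≢1; >-nonZero)
open import Data.Nat.Divisibility using (_∣_; _∣?_; divides; ∣1⇒≡1)
open import Data.Nat.GCD using (gcd; gcd-comm; gcd-assoc)
open import Data.Nat.ListAction using (product)
open import Data.Nat.Primality using (Prime; prime?; euclidsLemma)
open import Data.Nat.Properties
open import Data.Product using (_×_; Σ; ∃; _,_; proj₁; proj₂)
open import Data.Sum using (inj₁; inj₂; [_,_]′)
open import Data.Unit using (tt)
open import Function using (_∘_)
open import Function.Bundles using (Equivalence)
open import Relation.Nullary using (¬_; Dec; yes; no)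
open import Relation.Nullary.Decidable using (isYes; _×-dec_; toWitness; toWitnessFalse; from-yes)
open import Relation.Binary.PropositionalEquality using (_≡_; refl; sym; trans; cong; cong₂; subst; module ≡-Reasoning)
open import Algebra.Properties.CommutativeSemigroup (CommutativeRing.+-commutativeSemigroup xor-∧-commutativeRing) using (interchange)
open import Algebra.Properties.CommutativeSemigroup *-commutativeSemigroup using (xy∙z≈xz∙y)

pythagoreanTriple? : ∀ a b c → Dec (PythagoreanTriple a b c)
pythagoreanTriple? a b c = 1 ≤? a ×-dec 1 ≤? b ×-dec 1 ≤? c ×-dec a ^ 2 + b ^ 2 ≟ c ^ 2

primitivePythagoreanTriple? : ∀ a b c → Dec (PrimitivePythagoreanTriple a b c)
primitivePythagoreanTriple? a b c = pythagoreanTriple? a b c ×-dec gcd a (gcd b c) ≟ 1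

inRange? : ∀ N a b c → Dec (InRange N a b c)
inRange? N a b c = 1 ≤? a ×-dec a ≤? N ×-dec 1 ≤? b ×-dec b ≤? N ×-dec 1 ≤? c ×-dec c ≤? N

monochromatic? : ∀ f a b c → Dec (Monochromatic f a b c)
monochromatic? f a b c = f a Bool.≟ f b ×-dec f b Bool.≟ f c

primitivePythagoreanTriple-swap : ∀ {a b c} → PrimitivePythagoreanTriple a b c → PrimitivePythagoreanTriple b a c
primitivePythagoreanTriple-swap {a} {b} {c} ((1≤a , 1≤b , 1≤c , a²+b²≡c²) , coprime) =
  (1≤b , 1≤a , 1≤c , trans (+-comm (b ^ 2) (a ^ 2)) a²+b²≡c²) , (begin
    gcd b (gcd a c) ≡⟨ sym (gcd-assoc b a c) ⟩
    gcd (gcd b a) c ≡⟨ cong (λ d → gcd d c) (gcd-comm b a) ⟩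
    gcd (gcd a b) c ≡⟨ gcd-assoc a b c ⟩
    gcd a (gcd b c) ≡⟨ coprime ⟩
    1               ∎)
  where open ≡-Reasoning

inRange-swap : ∀ {N a b c} → InRange N a b c → InRange N b a c
inRange-swap (1≤a , a≤N , 1≤b , b≤N , 1≤c , c≤N) = 1≤b , b≤N , 1≤a , a≤N , 1≤c , c≤N

monochromatic-swap : ∀ {f a b c} → Monochromatic f a b c → Monochromatic f b a c
monochromatic-swap (fa≡fb , fb≡fc) = sym fa≡fb , trans fa≡fb fb≡fc

HasMonochromaticTriple : ℕ → (ℕ → Bool) → Set
HasMonochromaticTriple N f = ∃ λ a → ∃ λ b → ∃ λ c →
  PrimitivePythagoreanTriple a b c × InRange N a b c × Monochromatic f a b c

NoMonochromaticTriple : ℕ → (ℕ → Bool) → Set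
NoMonochromaticTriple N f = (a b c : ℕ) →
  PrimitivePythagoreanTriple a b c → InRange N a b c → ¬ Monochromatic f a b c

1≤m*n⇒1≤m : ∀ {m n} → 1 ≤ m * n → 1 ≤ m
1≤m*n⇒1≤m {suc m} _ = s≤s z≤n

1≤m*n⇒1≤n : ∀ m {n} → 1 ≤ m * n → 1 ≤ n
1≤m*n⇒1≤n m {n} rewrite *-comm m n = 1≤m*n⇒1≤m

-- Parity of p-adic valuations

-- oddValuation p n is v_p(n) mod 2: the fuel n suffices once p ≥ 2. The value at n = 0 is junk.
oddValuationWithin : ℕ → ℕ → ℕ → Bool
oddValuationWithin zero    p n       = false
oddValuationWithin (suc k) p zero    = false
oddValuationWithin (suc k) p (suc n) with p ∣? suc n
... | yes (divides q _) = not (oddValuationWithin k p q)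
... | no _              = false

oddValuation : ℕ → ℕ → Bool
oddValuation p n = oddValuationWithin n p n

oddValuation-∤ : ∀ {p n} → ¬ p ∣ n → oddValuation p n ≡ false
oddValuation-∤ {p} {zero}  _   = refl
oddValuation-∤ {p} {suc n} p∤n with p ∣? suc n
... | yes p∣n = ⊥-elim (p∤n p∣n)
... | no _    = refl

module _ {p : ℕ} .{{_ : NonTrivial p}} where

  private instance
    p≢0 : NonZero p
    p≢0 = nonTrivial⇒nonZero p

  quotient< : ∀ {q n} → suc n ≡ q * p → q < suc n
  quotient< {suc q} n≡q*p = subst (suc q <_) (sym n≡q*p) (m<m*n (suc q) p (nonTrivial⇒n>1 p))

  oddValuationWithin-fuel : ∀ {k k′ n} → n ≤ k → n ≤ k′ →
                            oddValuationWithin k p n ≡ oddValuationWithin k′ p n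
  oddValuationWithin-fuel {zero}  {zero}   {zero} _ _ = refl
  oddValuationWithin-fuel {zero}  {suc _}  {zero} _ _ = refl
  oddValuationWithin-fuel {suc _} {zero}   {zero} _ _ = refl
  oddValuationWithin-fuel {suc _} {suc _}  {zero} _ _ = refl
  oddValuationWithin-fuel {suc k} {suc k′} {suc n} (s≤s n≤k) (s≤s n≤k′) with p ∣? suc n
  ... | yes (divides q n≡q*p) =
    let q≤n = ≤-pred (quotient< n≡q*p) in
    cong not (oddValuationWithin-fuel (≤-trans q≤n n≤k) (≤-trans q≤n n≤k′))
  ... | no _ = refl

  oddValuation-1 : oddValuation p 1 ≡ false
  oddValuation-1 = oddValuation-∤ (nonTrivial⇒≢1 ∘ ∣1⇒≡1)

  oddValuation-*p : ∀ m {n} → 1 ≤ n → n ≡ m * p → oddValuation p n ≡ not (oddValuation p m)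
  oddValuation-*p m {suc n} _ n≡m*p with p ∣? suc n
  ... | no p∤n = ⊥-elim (p∤n (divides m n≡m*p))
  ... | yes (divides q n≡q*p) = cong not (begin
    oddValuationWithin n p q ≡⟨ oddValuationWithin-fuel (≤-pred (quotient< n≡q*p)) ≤-refl ⟩
    oddValuation p q         ≡⟨ cong (oddValuation p) (*-cancelʳ-≡ q m p (trans (sym n≡q*p) n≡m*p)) ⟩
    oddValuation p m         ∎)
    where open ≡-Reasoning

module _ {p : ℕ} (prime-p : Prime p) where

  open Prime prime-p

  oddValuation-*-bounded : ∀ k {x y} → x + y ≤ k → 1 ≤ x → 1 ≤ y →
                           oddValuation p (x * y) ≡ oddValuation p x xor oddValuation p y
  oddValuation-*-bounded zero    {suc _} () _ _
  oddValuation-*-bounded (suc k) {x} {y} x+y≤1+k 1≤x 1≤y with p ∣? x | p ∣? y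
  ... | yes (divides x′ refl) | _ = begin
    oddValuation p (x′ * p * y)                ≡⟨ oddValuation-*p (x′ * y) (*-mono-≤ 1≤x 1≤y) (xy∙z≈xz∙y x′ p y) ⟩
    not (oddValuation p (x′ * y))              ≡⟨ cong not (oddValuation-*-bounded k x′+y≤k 1≤x′ 1≤y) ⟩
    not (oddValuation p x′ xor oddValuation p y) ≡⟨ not-distribˡ-xor (oddValuation p x′) _ ⟩
    not (oddValuation p x′) xor oddValuation p y ≡⟨ cong (_xor oddValuation p y) (oddValuation-*p x′ 1≤x refl) ⟨
    oddValuation p (x′ * p) xor oddValuation p y ∎
    where
    open ≡-Reasoning
    1≤x′ : 1 ≤ x′
    1≤x′ = 1≤m*n⇒1≤m 1≤x
    x′+y≤k : x′ + y ≤ k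
    x′+y≤k = ≤-pred (≤-trans (+-monoˡ-< y (m<m*n x′ p {{>-nonZero 1≤x′}} (nonTrivial⇒n>1 p))) x+y≤1+k)
  ... | no _ | yes (divides y′ refl) = begin
    oddValuation p (x * (y′ * p))                ≡⟨ oddValuation-*p (x * y′) (*-mono-≤ 1≤x 1≤y) (sym (*-assoc x y′ p)) ⟩
    not (oddValuation p (x * y′))                ≡⟨ cong not (oddValuation-*-bounded k x+y′≤k 1≤x 1≤y′) ⟩
    not (oddValuation p x xor oddValuation p y′) ≡⟨ not-distribʳ-xor (oddValuation p x) _ ⟩
    oddValuation p x xor not (oddValuation p y′) ≡⟨ cong (oddValuation p x xor_) (oddValuation-*p y′ 1≤y refl) ⟨
    oddValuation p x xor oddValuation p (y′ * p) ∎
    where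
    open ≡-Reasoning
    1≤y′ : 1 ≤ y′
    1≤y′ = 1≤m*n⇒1≤m 1≤y
    x+y′≤k : x + y′ ≤ k
    x+y′≤k = ≤-pred (≤-trans (+-monoʳ-< x (m<m*n y′ p {{>-nonZero 1≤y′}} (nonTrivial⇒n>1 p))) x+y≤1+k)
  ... | no p∤x | no p∤y = begin
    oddValuation p (x * y)                    ≡⟨ oddValuation-∤ p∤xy ⟩
    false                                     ≡⟨⟩
    false xor false                           ≡⟨ cong₂ _xor_ (oddValuation-∤ p∤x) (oddValuation-∤ p∤y) ⟨
    oddValuation p x xor oddValuation p y     ∎
    where
    open ≡-Reasoning
    p∤xy : ¬ p ∣ x * y
    p∤xy p∣xy = [ p∤x , p∤y ]′ (euclidsLemma x y prime-p p∣xy)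

  oddValuation-* : ∀ {x y} → 1 ≤ x → 1 ≤ y →
                   oddValuation p (x * y) ≡ oddValuation p x xor oddValuation p y
  oddValuation-* {x} {y} = oddValuation-*-bounded (suc (x + y)) (n≤1+n (x + y))

oddValuationSum : List ℕ → ℕ → Bool
oddValuationSum []       n = false
oddValuationSum (p ∷ ps) n = oddValuation p n xor oddValuationSum ps n

oddValuationSum-isMonoidMorphism : ∀ {ps} → All Prime ps → IsMonoidMorphism (oddValuationSum ps)
oddValuationSum-isMonoidMorphism []                 = refl , λ _ _ _ _ → refl
oddValuationSum-isMonoidMorphism {p ∷ ps} (prime-p ∷ primes)
  with oddValuationSum-isMonoidMorphism primes
... | sum-1 , sum-* =
  cong₂ _xor_ oddValuation-1 sum-1 ,
  λ x y 1≤x 1≤y → trans (cong₂ _xor_ (oddValuation-* prime-p 1≤x 1≤y) (sum-* x y 1≤x 1≤y))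
    (interchange (oddValuation p x) (oddValuation p y) (oddValuationSum ps x) (oddValuationSum ps y))
  where open Prime prime-p

-- Decision-tree certificates

xorSum : (ℕ → Bool) → List ℕ → Bool
xorSum f []       = false
xorSum f (p ∷ ps) = f p xor xorSum f ps

morphism-product : ∀ {f} → IsMonoidMorphism f → ∀ ns → 1 ≤ product ns → f (product ns) ≡ xorSum f ns
morphism-product (f-1 , _)   []       _            = f-1
morphism-product {f} morphism@(_ , f-*) (n ∷ ns) 1≤n*ns = begin
  f (n * product ns)      ≡⟨ f-* n (product ns) (1≤m*n⇒1≤m 1≤n*ns) 1≤ns ⟩
  f n xor f (product ns)  ≡⟨ cong (f n xor_) (morphism-product morphism ns 1≤ns) ⟩
  f n xor xorSum f ns     ∎
  where
  open ≡-Reasoning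
  1≤ns : 1 ≤ product ns
  1≤ns = 1≤m*n⇒1≤n n 1≤n*ns

cancelCons : ℕ → List ℕ → List ℕ
cancelCons m []       = m ∷ []
cancelCons m (n ∷ ns) with m ≟ n
... | yes _ = ns
... | no _  = m ∷ n ∷ ns

cancelPairs : List ℕ → List ℕ
cancelPairs = foldr cancelCons []

xorSum-cancelCons : ∀ f m ns → xorSum f (cancelCons m ns) ≡ f m xor xorSum f ns
xorSum-cancelCons f m []       = refl
xorSum-cancelCons f m (n ∷ ns) with m ≟ n
... | yes refl = begin
  xorSum f ns                    ≡⟨⟩
  false xor xorSum f ns          ≡⟨ cong (_xor xorSum f ns) (xor-same (f m)) ⟨
  (f m xor f m) xor xorSum f ns  ≡⟨ xor-assoc (f m) (f m) (xorSum f ns) ⟩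
  f m xor (f m xor xorSum f ns)  ∎
  where open ≡-Reasoning
... | no _ = refl

xorSum-cancelPairs : ∀ f ns → xorSum f (cancelPairs ns) ≡ xorSum f ns
xorSum-cancelPairs f []       = refl
xorSum-cancelPairs f (n ∷ ns) =
  trans (xorSum-cancelCons f n (cancelPairs ns)) (cong (f n xor_) (xorSum-cancelPairs f ns))

-- Trial division. It needs no correctness proof: `colourUnder` checks the product it returns.
factorise : ℕ → List ℕ
factorise n = trialDivision (2 * n) 2 n
  where
  trialDivision : ℕ → ℕ → ℕ → List ℕ
  trialDivision zero    d n = []
  trialDivision (suc k) d n with n ≤? 1 | d ∣? n
  ... | yes _ | _                  = []
  ... | no _  | yes (divides q _)  = d ∷ trialDivision k d q
  ... | no _  | no _               = trialDivision k (suc d) n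

Assignment : Set
Assignment = List (ℕ × Bool)

Consistent : (ℕ → Bool) → Assignment → Set
Consistent f = All (λ (p , v) → f p ≡ v)

valueAt : Assignment → ℕ → Maybe Bool
valueAt []            p = nothing
valueAt ((q , v) ∷ ρ) p with p ≟ q
... | yes _ = just v
... | no _  = valueAt ρ p

valueAt-sound : ∀ {f ρ p v} → Consistent f ρ → valueAt ρ p ≡ just v → f p ≡ v
valueAt-sound {ρ = (q , w) ∷ ρ} {p} (fq≡w ∷ consistent) eq with p ≟ q | eq
... | yes refl | refl = fq≡w
... | no _     | eq′  = valueAt-sound consistent eq′

xorSumUnder : Assignment → List ℕ → Maybe Bool
xorSumUnder ρ []       = just false
xorSumUnder ρ (p ∷ ps) = zipWith _xor_ (valueAt ρ p) (xorSumUnder ρ ps)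

xorSumUnder-sound : ∀ {f ρ v} ps → Consistent f ρ → xorSumUnder ρ ps ≡ just v → xorSum f ps ≡ v
xorSumUnder-sound []       _          refl = refl
xorSumUnder-sound {ρ = ρ} (p ∷ ps) consistent eq
  with valueAt ρ p in eq-p | xorSumUnder ρ ps in eq-ps | eq
... | just _ | just _ | refl =
  cong₂ _xor_ (valueAt-sound consistent eq-p) (xorSumUnder-sound ps consistent eq-ps)

-- Primes dividing n to an even power cancel, so the assignment need not fix their colour.
colourUnder : Assignment → ℕ → Maybe Bool
colourUnder ρ n with product (factorise n) ≟ n
... | yes _ = xorSumUnder ρ (cancelPairs (factorise n))
... | no _  = nothing

colourUnder-sound : ∀ {f ρ n v} → IsMonoidMorphism f → Consistent f ρ → 1 ≤ n →
                    colourUnder ρ n ≡ just v → f n ≡ v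
colourUnder-sound {f} {ρ} {n} {v} morphism consistent 1≤n eq with product (factorise n) ≟ n
... | yes product≡n = begin
  f n                               ≡⟨ cong f product≡n ⟨
  f (product ns)                    ≡⟨ morphism-product morphism ns (subst (1 ≤_) (sym product≡n) 1≤n) ⟩
  xorSum f ns                       ≡⟨ xorSum-cancelPairs f ns ⟨
  xorSum f (cancelPairs ns)         ≡⟨ xorSumUnder-sound (cancelPairs ns) consistent eq ⟩
  v                                 ∎
  where
  open ≡-Reasoning
  ns : List ℕ
  ns = factorise n

sameColour : Maybe Bool → Maybe Bool → Bool
sameColour (just x) (just y) = isYes (x Bool.≟ y)
sameColour _        _        = false

sameColour-sound : ∀ {m m′} → T (sameColour m m′) → ∃ λ x → m ≡ just x × m′ ≡ just x
sameColour-sound {just x} {just y} x≡y = x , refl , cong just (sym (toWitness {a? = x Bool.≟ y} x≡y))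

data Certificate : Set where
  triple : ℕ → ℕ → ℕ → Certificate
  branch : ℕ → Certificate → Certificate → Certificate

validUnder : ℕ → Assignment → Certificate → Bool
validUnder N ρ (triple a b c) =
  isYes (primitivePythagoreanTriple? a b c ×-dec inRange? N a b c) ∧
  sameColour (colourUnder ρ a) (colourUnder ρ b) ∧ sameColour (colourUnder ρ b) (colourUnder ρ c)
validUnder N ρ (branch p left right) =
  validUnder N ((p , false) ∷ ρ) left ∧ validUnder N ((p , true) ∷ ρ) right

validUnder-sound : ∀ {N f ρ} → IsMonoidMorphism f → Consistent f ρ →
                   ∀ t → T (validUnder N ρ t) → HasMonochromaticTriple N f
validUnder-sound {f = f} morphism consistent (branch p left right) valid with f p in fp
... | false = validUnder-sound morphism (fp ∷ consistent) left (proj₁ (Equivalence.to T-∧ valid))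
... | true  = validUnder-sound morphism (fp ∷ consistent) right (proj₂ (Equivalence.to T-∧ valid))
validUnder-sound {N} {f} {ρ} morphism consistent (triple a b c) valid
  with Equivalence.to T-∧ valid
... | valid-triple , valid-colours
  with toWitness {a? = primitivePythagoreanTriple? a b c ×-dec inRange? N a b c} valid-triple
     | Equivalence.to T-∧ valid-colours
... | triple-abc@((1≤a , 1≤b , 1≤c , _) , _) , inRange | same-ab , same-bc
  with sameColour-sound same-ab | sameColour-sound same-bc
... | x , ca≡x , cb≡x | y , cb≡y , cc≡y =
  a , b , c , triple-abc , inRange ,
  trans (colour 1≤a ca≡x) (sym (colour 1≤b cb≡x)) , trans (colour 1≤b cb≡y) (sym (colour 1≤c cc≡y))
  where
  colour : ∀ {n v} → 1 ≤ n → colourUnder ρ n ≡ just v → f n ≡ v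
  colour = colourUnder-sound morphism consistent

-- Exhaustive search over pairs of legs

IsCeilSqrt : ℕ → ℕ → Set
IsCeilSqrt s c = pred c ^ 2 < s × s ≤ c ^ 2

isCeilSqrt? : ∀ s c → Dec (IsCeilSqrt s c)
isCeilSqrt? s c = pred c ^ 2 <? s ×-dec s ≤? c ^ 2

isCeilSqrt-unique : ∀ {c c₀} → IsCeilSqrt (c ^ 2) c₀ → c ≡ c₀
isCeilSqrt-unique {c} {c₀} (c₀-1²<c² , c²≤c₀²) = ≤-antisym c≤c₀ c₀≤c
  where
  c≤c₀ : c ≤ c₀
  c≤c₀ = ≮⇒≥ (λ c₀<c → <⇒≱ (^-monoˡ-< 2 c₀<c) c²≤c₀²)
  c₀≤c : c₀ ≤ c
  c₀≤c = ≮⇒≥ (λ c<c₀ → <⇒≱ c₀-1²<c² (^-monoˡ-≤ 2 (<⇒≤pred c<c₀)))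

-- Searches downwards from c₀ for the ceiling of √s. Callers check the result with isCeilSqrt?,
-- so nothing is proved about it.
ceilSqrtFrom : ℕ → ℕ → ℕ
ceilSqrtFrom zero    s = zero
ceilSqrtFrom (suc c) s with s ≤? c ^ 2
... | yes _ = ceilSqrtFrom c s
... | no _  = suc c

module _ (N : ℕ) (f : ℕ → Bool) where

  NoMonochromaticCompletion : ℕ → ℕ → Set
  NoMonochromaticCompletion a b =
    ∀ c → PrimitivePythagoreanTriple a b c → InRange N a b c → ¬ Monochromatic f a b c

  pairValid : ℕ → ℕ → ℕ → Bool
  pairValid a b c₀ =
    isYes (isCeilSqrt? (a ^ 2 + b ^ 2) c₀) ∧
    not (isYes (primitivePythagoreanTriple? a b c₀ ×-dec inRange? N a b c₀ ×-dec monochromatic? f a b c₀))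

  pairValid-sound : ∀ {a b c₀} → T (pairValid a b c₀) → NoMonochromaticCompletion a b
  pairValid-sound {a} {b} {c₀} valid c triple-abc@((_ , _ , _ , a²+b²≡c²) , _) inRange mono
    with Equivalence.to T-∧ valid
  ... | isCeilSqrt , noneAt-c₀
    with isCeilSqrt-unique {c} {c₀}
           (subst (λ s → IsCeilSqrt s c₀) a²+b²≡c² (toWitness {a? = isCeilSqrt? _ c₀} isCeilSqrt))
  ... | refl = toWitnessFalse noneAt-c₀ (triple-abc , inRange , mono)

  -- c₀ is the candidate hypotenuse for (a , k + a). Along a row the hypotenuse decreases with the
  -- second leg, so each candidate is a starting point for the next search.
  rowValid : ℕ → ℕ → ℕ → Bool
  rowValid a zero    c₀ = pairValid a a c₀
  rowValid a (suc k) c₀ =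
    pairValid a (suc k + a) c₀ ∧ rowValid a k (ceilSqrtFrom c₀ (a ^ 2 + (k + a) ^ 2))

  rowValid-sound : ∀ {a} k {c₀} → T (rowValid a k c₀) → ∀ {j} → j ≤ k → NoMonochromaticCompletion a (j + a)
  rowValid-sound zero    valid z≤n = pairValid-sound valid
  rowValid-sound (suc k) valid j≤1+k with Equivalence.to T-∧ valid | m≤n⇒m<n∨m≡n j≤1+k
  ... | valid-first , _          | inj₂ refl  = pairValid-sound valid-first
  ... | _           , valid-rest | inj₁ j<1+k = rowValid-sound k valid-rest (≤-pred j<1+k)

  tableValid : ℕ → Bool
  tableValid zero    = true
  tableValid (suc a) =
    rowValid (suc a) (N ∸ suc a) (ceilSqrtFrom (N + suc a) (suc a ^ 2 + N ^ 2)) ∧ tableValid a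

  tableValid-sound : ∀ n → T (tableValid n) →
                     ∀ {a b} → 1 ≤ a → a ≤ n → a ≤ b → b ≤ N → NoMonochromaticCompletion a b
  tableValid-sound zero    _     {suc _} _ ()
  tableValid-sound (suc n) valid {a} {b} 1≤a a≤1+n a≤b b≤N
    with Equivalence.to T-∧ valid | m≤n⇒m<n∨m≡n a≤1+n
  ... | valid-row , _ | inj₂ refl =
    subst (NoMonochromaticCompletion a) (m∸n+n≡m a≤b) (rowValid-sound (N ∸ a) valid-row (∸-monoˡ-≤ a b≤N))
  ... | _ , valid-rest | inj₁ a<1+n = tableValid-sound n valid-rest 1≤a (≤-pred a<1+n) a≤b b≤N

  tableValid⇒noMonochromaticTriple : T (tableValid N) → NoMonochromaticTriple N f
  tableValid⇒noMonochromaticTriple valid a b c triple-abc inRange@(1≤a , a≤N , 1≤b , b≤N , _)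
    with ≤-total a b
  ... | inj₁ a≤b = tableValid-sound N valid 1≤a a≤N a≤b b≤N c triple-abc inRange
  ... | inj₂ b≤a = tableValid-sound N valid 1≤b b≤N b≤a a≤N c
                     (primitivePythagoreanTriple-swap triple-abc) (inRange-swap inRange) ∘ monochromatic-swap {f}

monochromaticCertificate : Certificate
monochromaticCertificate =
  branch 5
   (branch 3
    (triple 3 4 5)
    (branch 7
     (branch 53
      (triple 28 45 53)
      (branch 13
       (triple 16 63 65)
       (branch 17
        (branch 89
         (triple 39 80 89)
         (branch 109
          (branch 29
           (triple 17 144 145)
           (branch 197
            (triple 28 195 197)
            (branch 229
             (branch 233
              (branch 353
               (triple 225 272 353)
               (branch 73
                (branch 421
                 (branch 31
                  (branch 2
                   (branch 41
                    (triple 9 40 41)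
                    (branch 61
                     (triple 136 273 305)
                     (branch 11
                      (triple 36 77 85)
                      (triple 11 60 61))))
                   (triple 7 24 25))
                  (triple 155 468 493))
                 (triple 29 420 421))
                (triple 27 364 365)))
              (triple 105 208 233))
             (triple 60 221 229))))
          (triple 60 91 109)))
        (triple 13 84 85))))
     (branch 29
      (triple 20 21 29)
      (branch 37
       (branch 113
        (branch 13
         (branch 17
          (triple 13 84 85)
          (branch 2
           (branch 41
            (triple 9 40 41)
            (branch 97
             (triple 65 72 97)
             (branch 109
              (branch 11
               (triple 44 117 125)
               (triple 24 143 145))
              (triple 60 91 109))))
           (triple 8 15 17)))
         (branch 89
          (triple 39 80 89)
          (branch 101
           (triple 336 377 505)
           (branch 2
            (branch 41
             (triple 9 40 41)
             (branch 11
              (triple 33 56 65)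
              (triple 308 435 533)))
            (branch 17
             (triple 104 153 185)
             (triple 8 15 17))))))
        (triple 15 112 113))
       (triple 12 35 37)))))
   (branch 3
    (branch 7
     (branch 13
      (branch 17
       (branch 29
        (branch 353
         (triple 225 272 353)
         (branch 73
          (branch 31
           (branch 97
            (branch 101
             (branch 2
              (triple 7 24 25)
              (triple 119 120 169))
             (triple 336 377 505))
            (triple 93 476 485))
           (triple 155 468 493))
          (triple 27 364 365)))
        (triple 17 144 145))
       (triple 13 84 85))
      (triple 16 63 65))
     (branch 29
      (branch 37
       (triple 12 35 37)
       (branch 53
        (branch 113
         (branch 421
          (triple 29 420 421)
          (branch 13
           (branch 109
            (branch 197
             (branch 233
              (triple 105 208 233)
              (branch 2
               (branch 11
                (branch 137
                 (triple 88 105 137)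
                 (branch 19
                  (triple 57 176 185)
                  (branch 181
                   (branch 41
                    (branch 17
                     (triple 104 153 185)
                     (triple 21 220 221))
                    (triple 133 156 205))
                   (triple 19 180 181))))
                (triple 33 56 65))
               (branch 17
                (branch 41
                 (triple 9 40 41)
                 (branch 97
                  (branch 149
                   (triple 51 140 149)
                   (branch 19
                    (triple 140 171 221)
                    (triple 133 156 205)))
                  (triple 65 72 97)))
                (triple 8 15 17))))
             (triple 28 195 197))
            (triple 60 91 109))
           (branch 17
            (triple 13 84 85)
            (branch 2
             (branch 89
              (branch 97
               (triple 65 72 97)
               (branch 11
                (branch 137
                 (triple 88 105 137)
                 (branch 157
                  (triple 85 132 157)
                  (branch 173
                   (branch 19
                    (triple 57 176 185)
                    (branch 181
                     (branch 41
                      (triple 84 187 205)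
                      (branch 241
                       (branch 257
                        (triple 32 255 257)
                        (branch 281
                         (branch 73
                          (branch 397
                           (branch 433
                            (branch 457
                             (branch 461
                              (triple 261 380 461)
                              (branch 31
                               (triple 93 476 485)
                               (branch 101
                                (triple 336 377 505)
                                (branch 509
                                 (branch 521
                                  (branch 23
                                   (triple 152 345 377)
                                   (triple 204 253 325))
                                  (triple 279 440 521))
                                 (triple 220 459 509)))))
                             (triple 168 425 457))
                            (triple 145 408 433))
                           (triple 228 325 397))
                          (triple 27 364 365))
                         (triple 160 231 281)))
                       (triple 120 209 241)))
                     (triple 19 180 181)))
                   (triple 52 165 173))))
                (triple 44 117 125)))
              (triple 39 80 89))
             (triple 8 15 17)))))
         (triple 15 112 113))
        (triple 28 45 53)))
      (triple 20 21 29)))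
    (branch 13
     (branch 89
      (branch 7
       (branch 29
        (branch 37
         (branch 109
          (triple 60 91 109)
          (branch 113
           (triple 15 112 113)
           (branch 197
            (triple 28 195 197)
            (branch 233
             (triple 105 208 233)
             (branch 23
              (triple 161 240 289)
              (branch 277
               (triple 115 252 277)
               (branch 349
                (branch 421
                 (triple 29 420 421)
                 (branch 41
                  (branch 19
                   (triple 84 437 445)
                   (triple 133 156 205))
                  (triple 92 525 533)))
                (triple 180 299 349))))))))
         (triple 12 35 37))
        (triple 20 21 29))
       (branch 53
        (branch 17
         (branch 2
          (triple 8 15 17)
          (branch 41
           (triple 9 40 41)
           (branch 97
            (branch 29
             (branch 229
              (triple 60 221 229)
              (branch 23
               (branch 269
                (branch 277
                 (branch 61
                  (branch 11
                   (triple 11 60 61)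
                   (triple 21 220 221))
                  (triple 207 224 305))
                 (triple 115 252 277))
                (triple 69 260 269))
               (triple 161 240 289)))
             (triple 17 144 145))
            (triple 65 72 97))))
         (triple 13 84 85))
        (triple 28 45 53)))
      (triple 39 80 89))
     (triple 5 12 13)))

extremalPrimes : List ℕ
extremalPrimes = 3 ∷ 7 ∷ 11 ∷ 13 ∷ 17 ∷ 19 ∷ 29 ∷ 41 ∷ 53 ∷ 89 ∷ 101 ∷ 257 ∷ 313 ∷ []

extremalColouring : ℕ → Bool
extremalColouring = oddValuationSum extremalPrimes

mainTheorem1 :
    ((f : ℕ → Bool) → IsMonoidMorphism f →
      ∃ λ a → ∃ λ b → ∃ λ c →
        PrimitivePythagoreanTriple a b c × InRange 533 a b c × Monochromatic f a b c)
    ×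
    (Σ (ℕ → Bool) λ f → IsMonoidMorphism f ×
      ((a b c : ℕ) → PrimitivePythagoreanTriple a b c → InRange 532 a b c →
        ¬ Monochromatic f a b c))
mainTheorem1 =
  (λ f morphism → validUnder-sound morphism [] monochromaticCertificate tt) ,
  extremalColouring ,
  oddValuationSum-isMonoidMorphism (from-yes (all? prime? extremalPrimes)) ,
  tableValid⇒noMonochromaticTriple 532 extremalColouring tt
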